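{- For all contracts with histories $\langle\vec\delta\rangle\rho$ and $\langle\vec\gamma\rangle\sigma$: if $\langle\vec\delta\rangle\rho$ is compliant with $\langle\vec\gamma\rangle\sigma$, then $\langle\vec\delta':\vec\delta\rangle\rho$ is compliant with $\langle\vec\gamma':\vec\gamma\rangle\sigma$ for all histories $\vec\delta',\vec\gamma'$ (where $\vec\delta':\vec\delta$ denotes the concatenation placing $\vec\delta'$ at the bottom of the stack and $\vec\delta$ on top).
   Context: Retractable contracts: closed expressions of $\sigma ::= \mathbf 1 \mid \sum_{i\in I} a_i.\sigma_i \mid \sum_{i\in I}\overline a_i.\sigma_i \mid \bigoplus_{i\in I}\overline a_i.\sigma_i \mid x \mid \mathsf{rec}\,x.\sigma$ over names $a$ and conames $\overline a$, $I$ non-empty finite, pairwise distinct (co)names per choice, $\sigma$ not a variable in $\mathsf{rec}\,x.\sigma$; equi-recursive, choices commutative, unary outputs of both kinds identified; $\alpha$ ranges over names and conames, $\overline{\overline a}=a$. Histories (stacks): $\vec\gamma::=[\,]\mid\vec\gamma:\sigma$ with $\sigma$ a contract or the symbol $\circ$; the top of the stack is the rightmost element. Contracts with histories: $\langle\vec\gamma\rangle\sigma$ with $\sigma$ a contract or $\circ$. LTS: $\langle\vec\gamma\rangle(\alpha.\sigma+\sigma')\xrightarrow{\alpha}\langle\vec\gamma:\sigma'\rangle\sigma$; $\langle\vec\gamma\rangle(\overline a.\sigma\oplus\sigma')\xrightarrow{\tau}\langle\vec\gamma\rangle\overline a.\sigma$; $\langle\vec\gamma\rangle\alpha.\sigma\xrightarrow{\alpha}\langle\vec\gamma:\circ\rangle\sigma$;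 $\langle\vec\gamma:\sigma'\rangle\sigma\xrightarrow{\mathsf{rb}}\langle\vec\gamma\rangle\sigma'$. Pair reduction: (comm) client does $\alpha$, server does $\overline\alpha$, both move; ($\tau$) a $\tau$-step of either side alone; (rbk) if the client's current contract $\neq\mathbf 1$ and both sides can do $\mathsf{rb}$, both do it, applicable only when neither (comm) nor ($\tau$) applies. Compliance: $\langle\vec\delta\rangle\rho$ is compliant with $\langle\vec\gamma\rangle\sigma$ if whenever $\langle\vec\delta\rangle\rho\,\|\,\langle\vec\gamma\rangle\sigma\to^*\langle\vec\delta''\rangle\rho'\,\|\,\langle\vec\gamma''\rangle\sigma'$ and the latter has no reduction, then $\rho'=\mathbf 1$. -}

module Defs where

open import Data.Nat using (ℕ; zero; suc)
open import Data.Fin using (Fin; zero; suc)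
open import Data.List using (List; []; _∷_)
open import Data.List.Relation.Unary.Unique.Propositional using (Unique)
open import Data.Product using (_×_; _,_; Σ; ∃)
open import Data.Sum using (_⊎_)
open import Data.Unit using (⊤)
open import Data.Empty using (⊥)
open import Relation.Nullary using (¬_)
open import Relation.Binary.Construct.Closure.ReflexiveTransitive using (Star)

Name : Set
Name = ℕ

data Act : Set where
  nm : Name → Act
  co : Name → Act

dual : Act → Act
dual (nm a) = co a
dual (co a) = nm a

-- Contract syntax, de Bruijn indices (n = number of free variables).
-- Branches = non-empty finite list of (name , continuation).

mutual
  data Contract (n : ℕ) : Set where
    𝟏   : Contract n
    inp : Branches n → Contract n
    out : Branches n → Contract n      -- Σ a̅_i . σ_i   (external output choice)
    ich : Branches n → Contract n      -- ⊕ a̅_i . σ_i   (internal choice)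
    var : Fin n → Contract n
    rec : Contract (suc n) → Contract n

  data Branches (n : ℕ) : Set where
    [_↦_]   : Name → Contract n → Branches n
    _↦_∷_   : Name → Contract n → Branches n → Branches n

infixr 5 _↦_∷_

liftR : ∀ {m n} → (Fin m → Fin n) → Fin (suc m) → Fin (suc n)
liftR r zero    = zero
liftR r (suc i) = suc (r i)

mutual
  ren : ∀ {m n} → (Fin m → Fin n) → Contract m → Contract n
  ren r 𝟏        = 𝟏
  ren r (inp bs) = inp (renB r bs)
  ren r (out bs) = out (renB r bs)
  ren r (ich bs) = ich (renB r bs)
  ren r (var i)  = var (r i)
  ren r (rec σ)  = rec (ren (liftR r) σ)

  renB : ∀ {m n} → (Fin m → Fin n) → Branches m → Branches n
  renB r [ a ↦ σ ]     = [ a ↦ ren r σ ]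
  renB r (a ↦ σ ∷ bs)  = a ↦ ren r σ ∷ renB r bs

liftS : ∀ {m n} → (Fin m → Contract n) → Fin (suc m) → Contract (suc n)
liftS s zero    = var zero
liftS s (suc i) = ren suc (s i)

mutual
  sub : ∀ {m n} → (Fin m → Contract n) → Contract m → Contract n
  sub s 𝟏        = 𝟏
  sub s (inp bs) = inp (subB s bs)
  sub s (out bs) = out (subB s bs)
  sub s (ich bs) = ich (subB s bs)
  sub s (var i)  = s i
  sub s (rec σ)  = rec (sub (liftS s) σ)

  subB : ∀ {m n} → (Fin m → Contract n) → Branches m → Branches n
  subB s [ a ↦ σ ]    = [ a ↦ sub s σ ]
  subB s (a ↦ σ ∷ bs) = a ↦ sub s σ ∷ subB s bs

single : ∀ {n} → Contract n → Fin (suc n) → Contract n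
single τ zero    = τ
single τ (suc i) = var i

unfold : ∀ {n} → Contract (suc n) → Contract n
unfold σ = sub (single (rec σ)) σ

names : ∀ {n} → Branches n → List Name
names [ a ↦ _ ]    = a ∷ []
names (a ↦ _ ∷ bs) = a ∷ names bs

NotVar : ∀ {n} → Contract n → Set
NotVar (var _) = ⊥
NotVar _       = ⊤

mutual
  WF : ∀ {n} → Contract n → Set
  WF 𝟏        = ⊤
  WF (inp bs) = Unique (names bs) × WFB bs
  WF (out bs) = Unique (names bs) × WFB bs
  WF (ich bs) = Unique (names bs) × WFB bs
  WF (var _)  = ⊤
  WF (rec σ)  = NotVar σ × WF σ

  WFB : ∀ {n} → Branches n → Set
  WFB [ _ ↦ σ ]    = WF σ
  WFB (_ ↦ σ ∷ bs) = WF σ × WFB bs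

Ctr : Set
Ctr = Contract zero

-- Selecting a branch from a choice with ≥ 2 branches, together with the
-- residual (the remaining, non-empty, choice).

data Sel {n : ℕ} : Branches n → Name → Contract n → Branches n → Set where
  hd   : ∀ {a σ rest} → Sel (a ↦ σ ∷ rest) a σ rest
  last : ∀ {a σ b τ} → Sel (b ↦ τ ∷ [ a ↦ σ ]) a σ [ b ↦ τ ]
  tl   : ∀ {a σ b τ bs rest} → Sel bs a σ rest →
         Sel (b ↦ τ ∷ bs) a σ (b ↦ τ ∷ rest)

-- Slots (a contract or ∘), histories (stacks, top = rightmost), states

data Slot : Set where
  ∘   : Slot
  ⌜_⌝ : Ctr → Slot

infixl 5 _∶_
data History : Set where
  []  : History
  _∶_ : History → Slot → History

-- δ' ++ δ : δ' at the bottom, δ on top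
infixl 4 _++_
_++_ : History → History → History
δ' ++ []      = δ'
δ' ++ (δ ∶ x) = (δ' ++ δ) ∶ x

record State : Set where
  constructor ⟨_⟩_
  field
    hist : History
    cur  : Slot
open State public

WFS : Slot → Set
WFS ∘     = ⊤
WFS ⌜ σ ⌝ = WF σ

WFH : History → Set
WFH []      = ⊤
WFH (γ ∶ x) = WFH γ × WFS x

-- LTS (equi-recursion: rec x.σ behaves as its unfolding)

data Label : Set where
  act : Act → Label
  τ   : Label
  rb  : Label

data _—[_]→_ : State → Label → State → Set where
  inpSum  : ∀ {γ bs a σ rest} → Sel bs a σ rest →
            (⟨ γ ⟩ ⌜ inp bs ⌝) —[ act (nm a) ]→ (⟨ γ ∶ ⌜ inp rest ⌝ ⟩ ⌜ σ ⌝)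
  outSum  : ∀ {γ bs a σ rest} → Sel bs a σ rest →
            (⟨ γ ⟩ ⌜ out bs ⌝) —[ act (co a) ]→ (⟨ γ ∶ ⌜ out rest ⌝ ⟩ ⌜ σ ⌝)
  intCh   : ∀ {γ bs a σ rest} → Sel bs a σ rest →
            (⟨ γ ⟩ ⌜ ich bs ⌝) —[ τ ]→ (⟨ γ ⟩ ⌜ out [ a ↦ σ ] ⌝)
  inpOne  : ∀ {γ a σ} →
            (⟨ γ ⟩ ⌜ inp [ a ↦ σ ] ⌝) —[ act (nm a) ]→ (⟨ γ ∶ ∘ ⟩ ⌜ σ ⌝)
  outOne  : ∀ {γ a σ} →
            (⟨ γ ⟩ ⌜ out [ a ↦ σ ] ⌝) —[ act (co a) ]→ (⟨ γ ∶ ∘ ⟩ ⌜ σ ⌝)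
  ichOne  : ∀ {γ a σ} →
            (⟨ γ ⟩ ⌜ ich [ a ↦ σ ] ⌝) —[ act (co a) ]→ (⟨ γ ∶ ∘ ⟩ ⌜ σ ⌝)
  rollback : ∀ {γ σ' σ} → (⟨ γ ∶ σ' ⟩ σ) —[ rb ]→ (⟨ γ ⟩ σ')
  unf     : ∀ {γ σ ℓ s} → (⟨ γ ⟩ ⌜ unfold σ ⌝) —[ ℓ ]→ s →
            (⟨ γ ⟩ ⌜ rec σ ⌝) —[ ℓ ]→ s

data IsOne : Ctr → Set where
  one : IsOne 𝟏
  unf : ∀ {σ} → IsOne (unfold σ) → IsOne (rec σ)

IsOneS : Slot → Set
IsOneS ∘     = ⊥
IsOneS ⌜ σ ⌝ = IsOne σ

Config : Set
Config = State × State

CommApplies : Config → Set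
CommApplies (c , s) = Σ Act λ α → Σ State λ c' → Σ State λ s' →
  (c —[ act α ]→ c') × (s —[ act (dual α) ]→ s')

TauApplies : Config → Set
TauApplies (c , s) = (∃ λ c' → c —[ τ ]→ c') ⊎ (∃ λ s' → s —[ τ ]→ s')

data _⇒_ : Config → Config → Set where
  comm : ∀ {c s c' s' α} → c —[ act α ]→ c' → s —[ act (dual α) ]→ s' →
         (c , s) ⇒ (c' , s')
  τL   : ∀ {c s c'} → c —[ τ ]→ c' → (c , s) ⇒ (c' , s)
  τR   : ∀ {c s s'} → s —[ τ ]→ s' → (c , s) ⇒ (c , s')
  rbk  : ∀ {c s c' s'} → ¬ IsOneS (cur c) →
         c —[ rb ]→ c' → s —[ rb ]→ s' →
         ¬ CommApplies (c , s) → ¬ TauApplies (c , s) →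
         (c , s) ⇒ (c' , s')

_⇒*_ : Config → Config → Set
_⇒*_ = Star _⇒_

Compliant : State → State → Set
Compliant c s = ∀ c' s' → (c , s) ⇒* (c' , s') →
  (∀ c'' s'' → ¬ ((c' , s') ⇒ (c'' , s''))) → IsOneS (cur c')

-- Non-rollback transitions read only the current contract and push at most one
-- slot on top of the history, so placing extra histories at the bottom of both
-- stacks relates the two pair systems step by step. The one exception is a
-- rollback that digs into the added part: it needs an original history to be
-- empty and neither communication nor τ to be possible, so the original pair is
-- then stuck with a client different from 1, which compliance rules out.
module Submission where

open import Defs
open import Data.Product using (_,_; _×_; ∃; proj₁; proj₂; map₁; map₂)
open import Data.Sum using (inj₁; inj₂)
open import Data.Empty using (⊥-elim)
open import Relation.Nullary using (¬_)
open import Relation.Binary.PropositionalEquality using (_≡_; refl)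
open import Relation.Binary.Construct.Closure.ReflexiveTransitive using (ε; _◅_)

underlay : History → State → State
underlay h (⟨ γ ⟩ x) = ⟨ h ++ γ ⟩ x

underlay₂ : History → History → Config → Config
underlay₂ h k (c , s) = underlay h c , underlay k s

data Forward : Label → Set where
  act : ∀ α → Forward (act α)
  τ   : Forward τ

step-underlay : ∀ h {s ℓ s'} → s —[ ℓ ]→ s' → underlay h s —[ ℓ ]→ underlay h s'
step-underlay h (inpSum sel) = inpSum sel
step-underlay h (outSum sel) = outSum sel
step-underlay h (intCh sel)  = intCh sel
step-underlay h inpOne       = inpOne
step-underlay h outOne       = outOne
step-underlay h ichOne       = ichOne
step-underlay h rollback     = rollback
step-underlay h (unf d)      = unf (step-underlay h d)

forward-step-unlay : ∀ h γ x {ℓ t} → Forward ℓ → (⟨ h ++ γ ⟩ x) —[ ℓ ]→ t →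
                     ∃ λ s' → ((⟨ γ ⟩ x) —[ ℓ ]→ s') × t ≡ underlay h s'
forward-step-unlay h γ x (act _) (inpSum sel) = _ , inpSum sel , refl
forward-step-unlay h γ x (act _) (outSum sel) = _ , outSum sel , refl
forward-step-unlay h γ x τ       (intCh sel)  = _ , intCh sel , refl
forward-step-unlay h γ x (act _) inpOne       = _ , inpOne , refl
forward-step-unlay h γ x (act _) outOne       = _ , outOne , refl
forward-step-unlay h γ x (act _) ichOne       = _ , ichOne , refl
forward-step-unlay h γ x f       (unf d)      = map₂ (map₁ unf) (forward-step-unlay h γ _ f d)

rollback-target : ∀ {γ x y t} → (⟨ γ ∶ x ⟩ y) —[ rb ]→ t → t ≡ ⟨ γ ⟩ x
rollback-target rollback = refl
rollback-target (unf d)  = rollback-target d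

no-rollback-from-[] : ∀ {x t} → ¬ ((⟨ [] ⟩ x) —[ rb ]→ t)
no-rollback-from-[] (unf d) = no-rollback-from-[] d

comm-applies-underlay : ∀ h k {X} → CommApplies X → CommApplies (underlay₂ h k X)
comm-applies-underlay h k (α , _ , _ , p , q) = α , _ , _ , step-underlay h p , step-underlay k q

comm-applies-unlay : ∀ h k {X} → CommApplies (underlay₂ h k X) → CommApplies X
comm-applies-unlay h k {⟨ γ ⟩ x , ⟨ δ ⟩ y} (α , _ , _ , p , q)
  with forward-step-unlay h γ x (act α) p | forward-step-unlay k δ y (act (dual α)) q
... | _ , p′ , _ | _ , q′ , _ = α , _ , _ , p′ , q′

tau-applies-underlay : ∀ h k {X} → TauApplies X → TauApplies (underlay₂ h k X)
tau-applies-underlay h k (inj₁ (_ , p)) = inj₁ (_ , step-underlay h p)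
tau-applies-underlay h k (inj₂ (_ , q)) = inj₂ (_ , step-underlay k q)

tau-applies-unlay : ∀ h k {X} → TauApplies (underlay₂ h k X) → TauApplies X
tau-applies-unlay h k {⟨ γ ⟩ x , _} (inj₁ (_ , p)) with forward-step-unlay h γ x τ p
... | _ , p′ , _ = inj₁ (_ , p′)
tau-applies-unlay h k {_ , ⟨ δ ⟩ y} (inj₂ (_ , q)) with forward-step-unlay k δ y τ q
... | _ , q′ , _ = inj₂ (_ , q′)

⇒-underlay : ∀ h k {X X'} → X ⇒ X' → underlay₂ h k X ⇒ underlay₂ h k X'
⇒-underlay h k (comm p q)         = comm (step-underlay h p) (step-underlay k q)
⇒-underlay h k (τL p)             = τL (step-underlay h p)
⇒-underlay h k (τR q)             = τR (step-underlay k q)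
⇒-underlay h k (rbk n p q ¬C ¬T) =
  rbk n (step-underlay h p) (step-underlay k q)
      (λ C → ¬C (comm-applies-unlay h k C)) (λ T → ¬T (tau-applies-unlay h k T))

Stuck : Config → Set
Stuck X = ∀ c s → ¬ (X ⇒ (c , s))

-- Compliant c s unfolds to: every reduct of (c , s) is Healthy.
Healthy : Config → Set
Healthy (c , s) = Stuck (c , s) → IsOneS (cur c)

stuck-unlay : ∀ h k {X} → Stuck (underlay₂ h k X) → Stuck X
stuck-unlay h k stuck c s st = stuck _ _ (⇒-underlay h k st)

healthy-underlay : ∀ h k {c s} → Healthy (c , s) → Healthy (underlay₂ h k (c , s))
healthy-underlay h k {⟨ _ ⟩ _} healthy stuck = healthy (stuck-unlay h k stuck)

rollback-only-unlay : ∀ h k {c s c' s'} →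
  ¬ CommApplies (underlay₂ h k (c , s)) → ¬ TauApplies (underlay₂ h k (c , s)) →
  (c , s) ⇒ (c' , s') → (c —[ rb ]→ c') × (s —[ rb ]→ s')
rollback-only-unlay h k ¬C ¬T (comm p q)       = ⊥-elim (¬C (comm-applies-underlay h k (_ , _ , _ , p , q)))
rollback-only-unlay h k ¬C ¬T (τL p)           = ⊥-elim (¬T (tau-applies-underlay h k (inj₁ (_ , p))))
rollback-only-unlay h k ¬C ¬T (τR q)           = ⊥-elim (¬T (tau-applies-underlay h k (inj₂ (_ , q))))
rollback-only-unlay h k ¬C ¬T (rbk _ p q _ _)  = p , q

rollback-unlay : ∀ h k γ x δ y {c' s'} → Healthy (⟨ γ ⟩ x , ⟨ δ ⟩ y) → ¬ IsOneS x →
  ¬ CommApplies (⟨ h ++ γ ⟩ x , ⟨ k ++ δ ⟩ y) → ¬ TauApplies (⟨ h ++ γ ⟩ x , ⟨ k ++ δ ⟩ y) →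
  (⟨ h ++ γ ⟩ x) —[ rb ]→ c' → (⟨ k ++ δ ⟩ y) —[ rb ]→ s' →
  ∃ λ X' → (⟨ γ ⟩ x , ⟨ δ ⟩ y) ⇒ X' × (c' , s') ≡ underlay₂ h k X'
rollback-unlay h k [] x δ y healthy ¬one ¬C ¬T _ _ =
  ⊥-elim (¬one (healthy λ _ _ st → no-rollback-from-[] (proj₁ (rollback-only-unlay h k ¬C ¬T st))))
rollback-unlay h k (_ ∶ _) x [] y healthy ¬one ¬C ¬T _ _ =
  ⊥-elim (¬one (healthy λ _ _ st → no-rollback-from-[] (proj₂ (rollback-only-unlay h k ¬C ¬T st))))
rollback-unlay h k (_ ∶ _) x (_ ∶ _) y healthy ¬one ¬C ¬T p q
  with rollback-target p | rollback-target q
... | refl | refl =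
  _ , rbk ¬one rollback rollback (λ C → ¬C (comm-applies-underlay h k C))
                                 (λ T → ¬T (tau-applies-underlay h k T)) , refl

⇒-unlay : ∀ h k {c s Y} → Healthy (c , s) → underlay₂ h k (c , s) ⇒ Y →
          ∃ λ X' → (c , s) ⇒ X' × Y ≡ underlay₂ h k X'
⇒-unlay h k {⟨ γ ⟩ x} {⟨ δ ⟩ y} _ (comm {α = α} p q)
  with forward-step-unlay h γ x (act α) p | forward-step-unlay k δ y (act (dual α)) q
... | _ , p′ , refl | _ , q′ , refl = _ , comm p′ q′ , refl
⇒-unlay h k {⟨ γ ⟩ x} _ (τL p) with forward-step-unlay h γ x τ p
... | _ , p′ , refl = _ , τL p′ , refl
⇒-unlay h k {s = ⟨ δ ⟩ y} _ (τR q) with forward-step-unlay k δ y τ q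
... | _ , q′ , refl = _ , τR q′ , refl
⇒-unlay h k {⟨ γ ⟩ x} {⟨ δ ⟩ y} healthy (rbk ¬one p q ¬C ¬T) =
  rollback-unlay h k γ x δ y healthy ¬one ¬C ¬T p q

⇒*-unlay : ∀ h k {c s Y} → Compliant c s → underlay₂ h k (c , s) ⇒* Y →
           ∃ λ X' → (c , s) ⇒* X' × Y ≡ underlay₂ h k X'
⇒*-unlay h k {c} {s} compliant ε = (c , s) , ε , refl
⇒*-unlay h k {c} {s} compliant (st ◅ sts) with ⇒-unlay h k (compliant c s ε) st
... | (c₁ , s₁) , st′ , refl with ⇒*-unlay h k (λ c' s' sts′ → compliant c' s' (st′ ◅ sts′)) sts
... | X' , sts′ , eq = X' , st′ ◅ sts′ , eq

mainTheorem5 : (δ : History) (ρ : Slot) (γ : History) (σ : Slot) →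
    WFH δ → WFS ρ → WFH γ → WFS σ →
    Compliant (⟨ δ ⟩ ρ) (⟨ γ ⟩ σ) →
    (δ' γ' : History) → WFH δ' → WFH γ' →
    Compliant (⟨ δ' ++ δ ⟩ ρ) (⟨ γ' ++ γ ⟩ σ)
mainTheorem5 δ ρ γ σ _ _ _ _ compliant δ' γ' _ _ c' s' reduces
  with ⇒*-unlay δ' γ' compliant reduces
... | (c , s) , reduces′ , refl = healthy-underlay δ' γ' (compliant c s reduces′)
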